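{- Let $E$ be a principal ideal domain, $k\ge1$, and let $f_1,\ldots,f_k\in E[x]$ and $\mathcal{R}\subseteq E[x]$ define a simultaneous digit system $(V,\phi,N)$. Then $(V,\phi,N)$ has the Finite Expansion Property if and only if (i) $(f_i,f_j)=(1)$ as ideals of $E[x]$ for all $i\ne j$, and (ii) the digit system $(E[x]/(f_1f_2\cdots f_k),X,\mathcal{R})$ (digits taken as residue classes) has the Finite Expansion Property.
   Context: Simultaneous digit system: $f_1,\ldots,f_k\in E[x]$ are pairwise coprime (pairwise trivial gcd), $f_1(0),\ldots,f_k(0)$ are pairwise coprime in $E$, and $\mathcal{R}\subseteq E[x]$ is a set of polynomials whose constant coefficients form a complete system of representatives of $E$ modulo $f_1(0)\cdots f_k(0)$. Then $V=E[x]/(f_1)\times\cdots\times E[x]/(f_k)$, $\phi(a_1,\ldots,a_k)=(Xa_1,\ldots,Xa_k)$ with $X$ the residue class of $x$, and $N=\{(c,\ldots,c)\mid c\in\mathcal{R}\}$ (the $i$-th component read modulo $f_i$). A triple $(V,\phi,D)$ has the Finite Expansion Property if every $v\in V$ equals $\sum_{i=0}^\ell\phi^i(d_i)$ with $d_i\in D$. $(f_i,f_j)$ is the ideal generated by $f_i,f_j$. -}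

module Defs where

open import Level using (Level; _⊔_) renaming (suc to lsuc)
open import Algebra.Bundles using (CommutativeRing)
open import Data.Nat using (ℕ; zero; suc)
open import Data.Fin using (Fin)
import Data.Fin as Fin
open import Data.List using (List; []; _∷_; map)
open import Data.Vec using (Vec; []; _∷_)
open import Data.Vec.Relation.Unary.All using (All)
open import Data.Product using (∃; _×_)
open import Data.Sum using (_⊎_)
open import Function using (_∘_)
open import Relation.Unary using (Pred; _∈_)
open import Relation.Nullary using (¬_)
open import Relation.Binary.PropositionalEquality using (_≡_)

module Over {c ℓ : Level} (E : CommutativeRing c ℓ) where
  open CommutativeRing E using (Carrier; _≈_; _+_; _*_; -_; _-_; 0#; 1#)

  _∣E_ : Carrier → Carrier → Set (c ⊔ ℓ)
  a ∣E b = ∃ λ q → b ≈ a * q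

  record IsIdeal (I : Pred Carrier (c ⊔ ℓ)) : Set (c ⊔ ℓ) where
    field
      resp  : ∀ {x y} → x ≈ y → I x → I y
      zero∈ : I 0#
      +∈    : ∀ {x y} → I x → I y → I (x + y)
      *∈    : ∀ r {x} → I x → I (r * x)

  record IsPID : Set (lsuc (c ⊔ ℓ)) where
    field
      nontrivial : ¬ (1# ≈ 0#)
      noZeroDiv  : ∀ x y → x * y ≈ 0# → (x ≈ 0#) ⊎ (y ≈ 0#)
      principal  : ∀ I → IsIdeal I → ∃ λ g → I g × (∀ x → I x → g ∣E x)

  -- Polynomials E[x] as coefficient lists (lowest degree first),
  -- equal when all coefficients agree (trailing zeros irrelevant).
  Pol : Set c
  Pol = List Carrier

  coeff : Pol → ℕ → Carrier
  coeff []      _       = 0#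
  coeff (a ∷ p) zero    = a
  coeff (a ∷ p) (suc n) = coeff p n

  _≈P_ : Pol → Pol → Set ℓ
  p ≈P q = ∀ n → coeff p n ≈ coeff q n

  _+P_ : Pol → Pol → Pol
  []      +P q       = q
  (a ∷ p) +P []      = a ∷ p
  (a ∷ p) +P (b ∷ q) = (a + b) ∷ (p +P q)

  -P_ : Pol → Pol
  -P p = map -_ p

  _-P_ : Pol → Pol → Pol
  p -P q = p +P (-P q)

  _·P_ : Carrier → Pol → Pol
  a ·P p = map (a *_) p

  _*P_ : Pol → Pol → Pol
  []      *P q = []
  (a ∷ p) *P q = (a ·P q) +P (0# ∷ (p *P q))

  0P 1P X : Pol
  0P = []
  1P = 1# ∷ []
  X  = 0# ∷ 1# ∷ []

  ev0 : Pol → Carrier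
  ev0 p = coeff p 0

  _∣P_ : Pol → Pol → Set (c ⊔ ℓ)
  f ∣P g = ∃ λ h → g ≈P (f *P h)

  _≡P_[mod_] : Pol → Pol → Pol → Set (c ⊔ ℓ)
  a ≡P b [mod f ] = f ∣P (a -P b)

  prodP : ∀ {k} → (Fin k → Pol) → Pol
  prodP {zero}  f = 1P
  prodP {suc k} f = f Fin.zero *P prodP (f ∘ Fin.suc)

  prodE : ∀ {k} → (Fin k → Carrier) → Carrier
  prodE {zero}  f = 1#
  prodE {suc k} f = f Fin.zero * prodE (f ∘ Fin.suc)

  horner : ∀ {n} → Vec Pol n → Pol
  horner []       = 0P
  horner (d ∷ ds) = d +P (X *P horner ds)

  UnitIdeal : Pol → Pol → Set (c ⊔ ℓ)
  UnitIdeal f g = ∃ λ u → ∃ λ v → ((u *P f) +P (v *P g)) ≈P 1P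

  record IsSimDigitSystem {r} (k : ℕ) (f : Fin k → Pol) (ℛ : Pred Pol r)
         : Set (c ⊔ ℓ ⊔ r) where
    field
      polyCoprime  : ∀ i j → ¬ (i ≡ j) → ∀ d → d ∣P f i → d ∣P f j → d ∣P 1P
      constCoprime : ∀ i j → ¬ (i ≡ j) → ∀ e → e ∣E ev0 (f i) → e ∣E ev0 (f j) → e ∣E 1#
      repSurj : ∀ a → ∃ λ d → d ∈ ℛ × (prodE (ev0 ∘ f) ∣E (a - ev0 d))
      repInj  : ∀ d d′ → d ∈ ℛ → d′ ∈ ℛ →
                prodE (ev0 ∘ f) ∣E (ev0 d - ev0 d′) → d ≈P d′

  -- Finite Expansion Property of (V, φ, N), V = Π E[x]/(f_i), φ = mult. by X,
  -- N = {(d,...,d) | d ∈ ℛ}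
  SimFEP : ∀ {r} (k : ℕ) → (Fin k → Pol) → Pred Pol r → Set (c ⊔ ℓ ⊔ r)
  SimFEP k f ℛ = ∀ (v : Fin k → Pol) → ∃ λ ℓ′ → ∃ λ (ds : Vec Pol (suc ℓ′)) →
                 All ℛ ds × (∀ i → v i ≡P horner ds [mod f i ])

  FEP : ∀ {r} → Pol → Pred Pol r → Set (c ⊔ ℓ ⊔ r)
  FEP F ℛ = ∀ (v : Pol) → ∃ λ ℓ′ → ∃ λ (ds : Vec Pol (suc ℓ′)) →
            All ℛ ds × (v ≡P horner ds [mod F ])

{-# OPTIONS --safe #-}
-- A common solution x of x ≡ 1 (mod fᵢ), x ≡ 0 (mod fⱼ) writes 1 = (1 - x) + x
-- with 1 - x ∈ (fᵢ) and x ∈ (fⱼ), so simultaneous expansions of all tuples force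
-- the fᵢ to be pairwise comaximal. For pairwise comaximal moduli, divisibility by
-- every fᵢ is divisibility by f₁⋯f_k, and the Chinese remainder theorem lifts any
-- tuple (v₁, …, v_k) to a single polynomial p with p ≡ vᵢ (mod fᵢ). Hence
-- expansions modulo f₁⋯f_k of p are simultaneous expansions of the tuple, and
-- simultaneous expansions of the diagonal (a, …, a) are expansions of a modulo
-- f₁⋯f_k.
module Submission where

open import Defs
open import Level using (Level; _⊔_)
open import Algebra.Bundles using (CommutativeRing; AbelianGroup)
open import Algebra.Structures using (IsAbelianGroup)
open import Data.Bool using (if_then_else_)
open import Data.List using ([]; _∷_)
open import Data.Nat using (ℕ; zero; suc; _≤_)
open import Data.Fin using (Fin)
import Data.Fin as Fin
open import Data.Fin.Properties using (suc-injective)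
open import Data.Product using (_×_; _,_; ∃; ∃₂)
open import Data.Product.Function.NonDependent.Propositional using (_×-⇔_)
open import Data.Vec using (Vec)
open import Data.Vec.Relation.Unary.All using (All)
open import Function using (_∘_; _⟨_⟩_)
open import Function.Bundles using (_⇔_; mk⇔; Equivalence)
open import Function.Properties.Equivalence using () renaming (trans to ⇔-trans; sym to ⇔-sym)
open import Relation.Binary.Bundles using (Setoid)
open import Relation.Binary.PropositionalEquality using (_≡_; _≢_)
import Relation.Binary.PropositionalEquality as ≡
open import Relation.Nullary using (¬_; does)
open import Relation.Nullary.Decidable using (dec-true; dec-false)
open import Relation.Unary using (Pred)

module Comaximality {c ℓ : Level} (R : CommutativeRing c ℓ) where
  open CommutativeRing R
  open import Algebra.Properties.Ring ring
    using (-‿distribˡ-*; -0#≈0#; ⁻¹-anti-homo‿-; -‿+-comm; x[y-z]≈xy-xz)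
  open import Algebra.Properties.CommutativeSemigroup +-commutativeSemigroup
    using () renaming (interchange to +-interchange)
  open import Algebra.Properties.CommutativeSemigroup.Divisibility *-commutativeSemigroup public
    using (_∣_; _,_)
  open import Algebra.Properties.CommutativeSemigroup.Divisibility *-commutativeSemigroup
    using (∣-respʳ-≈; ∣ʳ-trans; x∣xy; x∣yx; x∣ʳy⇒x∣ʳzy; x∣ʳy⇒xz∣ʳyz; x∣y⇒zx∣zy; ∙-cong-∣)
  open import Algebra.Properties.Semiring.Divisibility semiring using (_∣0; 1∣_)
  open import Relation.Binary.Reasoning.Setoid setoid

  x∣y∧x∣z⇒x∣y+z : ∀ {x y z} → x ∣ y → x ∣ z → x ∣ y + z
  x∣y∧x∣z⇒x∣y+z {x} (p , px≈y) (q , qx≈z) = p + q , trans (distribʳ x p q) (+-cong px≈y qx≈z)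

  x∣y⇒x∣-y : ∀ {x y} → x ∣ y → x ∣ - y
  x∣y⇒x∣-y {x} (p , px≈y) = - p , trans (sym (-‿distribˡ-* p x)) (-‿cong px≈y)

  infix 4 _≈_[mod_]
  _≈_[mod_] : Carrier → Carrier → Carrier → Set (c ⊔ ℓ)
  a ≈ b [mod f ] = f ∣ a - b

  [x-y]+[y-z]≈x-z : ∀ x y z → (x - y) + (y - z) ≈ x - z
  [x-y]+[y-z]≈x-z x y z = begin
    (x - y) + (y - z)    ≈⟨ +-assoc x (- y) (y - z) ⟩
    x + (- y + (y - z))  ≈⟨ +-congˡ (+-assoc (- y) y (- z)) ⟨
    x + ((- y + y) - z)  ≈⟨ +-congˡ (+-congʳ (-‿inverseˡ y)) ⟩
    x + (0# - z)         ≈⟨ +-congˡ (+-identityˡ (- z)) ⟩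
    x - z                ∎

  x-0≈x : ∀ x → x - 0# ≈ x
  x-0≈x x = trans (+-congˡ -0#≈0#) (+-identityʳ x)

  module _ {f : Carrier} where

    mod-reflexive : ∀ {a b} → a ≈ b → a ≈ b [mod f ]
    mod-reflexive {a} {b} a≈b = ∣-respʳ-≈ (sym (trans (+-congʳ a≈b) (-‿inverseʳ b))) (f ∣0)

    mod-sym : ∀ {a b} → a ≈ b [mod f ] → b ≈ a [mod f ]
    mod-sym {a} {b} = ∣-respʳ-≈ (⁻¹-anti-homo‿- a b) ∘ x∣y⇒x∣-y

    mod-trans : ∀ {a b d} → a ≈ b [mod f ] → b ≈ d [mod f ] → a ≈ d [mod f ]
    mod-trans {a} {b} {d} a≈b b≈d = ∣-respʳ-≈ ([x-y]+[y-z]≈x-z a b d) (x∣y∧x∣z⇒x∣y+z a≈b b≈d)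

    mod-+-cong : ∀ {a b a′ b′} → a ≈ a′ [mod f ] → b ≈ b′ [mod f ] → a + b ≈ a′ + b′ [mod f ]
    mod-+-cong {a} {b} {a′} {b′} a≈a′ b≈b′ = ∣-respʳ-≈ (begin
      (a - a′) + (b - b′)      ≈⟨ +-interchange a (- a′) b (- b′) ⟩
      (a + b) + (- a′ - b′)    ≈⟨ +-congˡ (-‿+-comm a′ b′) ⟩
      (a + b) - (a′ + b′)      ∎) (x∣y∧x∣z⇒x∣y+z a≈a′ b≈b′)

    mod-*-cong : ∀ {a b a′ b′} → a ≈ a′ [mod f ] → b ≈ b′ [mod f ] → a * b ≈ a′ * b′ [mod f ]
    mod-*-cong {a} {b} {a′} {b′} a≈a′ b≈b′ = ∣-respʳ-≈ (begin
      b * (a - a′) + a′ * (b - b′)           ≈⟨ +-cong (x[y-z]≈xy-xz b a a′) (x[y-z]≈xy-xz a′ b b′) ⟩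
      (b * a - b * a′) + (a′ * b - a′ * b′)  ≈⟨ +-cong (+-congʳ (*-comm b a)) (+-congʳ (*-comm a′ b)) ⟩
      (a * b - b * a′) + (b * a′ - a′ * b′)  ≈⟨ [x-y]+[y-z]≈x-z (a * b) (b * a′) (a′ * b′) ⟩
      a * b - a′ * b′                        ∎)
      (x∣y∧x∣z⇒x∣y+z (x∣ʳy⇒x∣ʳzy b a≈a′) (x∣ʳy⇒x∣ʳzy a′ b≈b′))

    ∣⇒≈0[mod] : ∀ {a} → f ∣ a → a ≈ 0# [mod f ]
    ∣⇒≈0[mod] {a} = ∣-respʳ-≈ (sym (x-0≈x a))

    ≈0[mod]⇒∣ : ∀ {a} → a ≈ 0# [mod f ] → f ∣ a
    ≈0[mod]⇒∣ {a} = ∣-respʳ-≈ (x-0≈x a)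

  mod-∣ : ∀ {f g a b} → g ∣ f → a ≈ b [mod f ] → a ≈ b [mod g ]
  mod-∣ = ∣ʳ-trans

  Comaximal : Carrier → Carrier → Set (c ⊔ ℓ)
  Comaximal f g = ∃₂ λ u v → u * f + v * g ≈ 1#

  comaximal-sym : ∀ {f g} → Comaximal f g → Comaximal g f
  comaximal-sym {f} {g} (u , v , uf+vg≈1) = v , u , trans (+-comm (v * g) (u * f)) uf+vg≈1

  comaximal⇒separator : ∀ {f g} → Comaximal f g → ∃ λ e → e ≈ 1# [mod f ] × g ∣ e
  comaximal⇒separator {f} {g} (u , v , uf+vg≈1) = v * g , (- u , (begin
    - u * f                       ≈⟨ -‿distribˡ-* u f ⟨
    - (u * f)                     ≈⟨ +-identityˡ _ ⟨
    0# - u * f                    ≈⟨ +-congʳ (-‿inverseʳ (v * g)) ⟨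
    (v * g - v * g) - u * f       ≈⟨ +-assoc (v * g) (- (v * g)) (- (u * f)) ⟩
    v * g + (- (v * g) - u * f)   ≈⟨ +-congˡ (-‿+-comm (v * g) (u * f)) ⟩
    v * g - (v * g + u * f)       ≈⟨ +-congˡ (-‿cong (trans (+-comm (v * g) (u * f)) uf+vg≈1)) ⟩
    v * g - 1#                    ∎)) , x∣yx g v

  separator⇒comaximal : ∀ {f g e} → e ≈ 1# [mod f ] → g ∣ e → Comaximal f g
  separator⇒comaximal {f} {g} {e} (t , tf≈e-1) (q , qg≈e) = - t , q , (begin
    - t * f + q * g     ≈⟨ +-cong (trans (sym (-‿distribˡ-* t f)) (-‿cong tf≈e-1)) qg≈e ⟩
    - (e - 1#) + e      ≈⟨ +-congʳ (⁻¹-anti-homo‿- e 1#) ⟩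
    (1# - e) + e        ≈⟨ +-assoc 1# (- e) e ⟩
    1# + (- e + e)      ≈⟨ +-congˡ (-‿inverseˡ e) ⟩
    1# + 0#             ≈⟨ +-identityʳ 1# ⟩
    1#                  ∎)

  comaximal-*ʳ : ∀ {f g h} → Comaximal f g → Comaximal f h → Comaximal f (g * h)
  comaximal-*ʳ f⊥g f⊥h with comaximal⇒separator f⊥g | comaximal⇒separator f⊥h
  ... | e , e≈1 , g∣e | e′ , e′≈1 , h∣e′ =
    separator⇒comaximal (mod-trans (mod-*-cong e≈1 e′≈1) (mod-reflexive (*-identityˡ 1#)))
                        (∙-cong-∣ g∣e h∣e′)

  comaximal⇒*∣ : ∀ {f g a} → Comaximal f g → f ∣ a → g ∣ a → f * g ∣ a
  comaximal⇒*∣ {f} {g} {a} (u , v , uf+vg≈1) f∣a g∣a = ∣-respʳ-≈ (begin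
    u * (f * a) + v * (a * g)  ≈⟨ +-cong (*-assoc u f a) (trans (*-assoc v g a) (*-congˡ (*-comm g a))) ⟨
    u * f * a + v * g * a      ≈⟨ distribʳ a (u * f) (v * g) ⟨
    (u * f + v * g) * a        ≈⟨ *-congʳ uf+vg≈1 ⟩
    1# * a                     ≈⟨ *-identityˡ a ⟩
    a                          ∎)
    (x∣y∧x∣z⇒x∣y+z (x∣ʳy⇒x∣ʳzy u (x∣y⇒zx∣zy f g∣a)) (x∣ʳy⇒x∣ʳzy v (x∣ʳy⇒xz∣ʳyz g f∣a)))

  ∏ : ∀ {k} → (Fin k → Carrier) → Carrier
  ∏ {zero}  f = 1#
  ∏ {suc k} f = f Fin.zero * ∏ (f ∘ Fin.suc)

  ∣∏ : ∀ {k} (f : Fin k → Carrier) i → f i ∣ ∏ f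
  ∣∏ f Fin.zero    = x∣xy (f Fin.zero) _
  ∣∏ f (Fin.suc i) = ∣ʳ-trans (∣∏ (f ∘ Fin.suc) i) (x∣yx _ (f Fin.zero))

  comaximal-∏ : ∀ {k f} (g : Fin k → Carrier) → (∀ j → Comaximal f (g j)) → Comaximal f (∏ g)
  comaximal-∏ {zero}  g _   = 0# , 1# , trans (+-congʳ (zeroˡ _)) (trans (+-identityˡ _) (*-identityˡ 1#))
  comaximal-∏ {suc k} g f⊥g = comaximal-*ʳ (f⊥g Fin.zero) (comaximal-∏ (g ∘ Fin.suc) (f⊥g ∘ Fin.suc))

  PairwiseComaximal : ∀ {k} → (Fin k → Carrier) → Set (c ⊔ ℓ)
  PairwiseComaximal f = ∀ i j → i ≢ j → Comaximal (f i) (f j)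

  module _ {k} {f : Fin (suc k) → Carrier} (pairwise : PairwiseComaximal f) where

    pairwiseComaximal-tail : PairwiseComaximal (f ∘ Fin.suc)
    pairwiseComaximal-tail i j i≢j = pairwise (Fin.suc i) (Fin.suc j) (i≢j ∘ suc-injective)

    comaximal-head-∏tail : Comaximal (f Fin.zero) (∏ (f ∘ Fin.suc))
    comaximal-head-∏tail = comaximal-∏ (f ∘ Fin.suc) (λ j → pairwise Fin.zero (Fin.suc j) λ ())

  pairwiseComaximal⇒∏∣ : ∀ {k a} {f : Fin k → Carrier} → PairwiseComaximal f → (∀ i → f i ∣ a) → ∏ f ∣ a
  pairwiseComaximal⇒∏∣ {zero}  _        _   = 1∣ _
  pairwiseComaximal⇒∏∣ {suc k} pairwise f∣a = comaximal⇒*∣ (comaximal-head-∏tail pairwise) (f∣a Fin.zero)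
    (pairwiseComaximal⇒∏∣ (pairwiseComaximal-tail pairwise) (f∣a ∘ Fin.suc))

  *+*≈[mod] : ∀ {f e e′} x y → e ≈ 1# [mod f ] → e′ ≈ 0# [mod f ] → x * e + y * e′ ≈ x [mod f ]
  *+*≈[mod] x y e≈1 e′≈0 = mod-trans
    (mod-+-cong (mod-*-cong (mod-reflexive refl) e≈1) (mod-*-cong (mod-reflexive refl) e′≈0))
    (mod-reflexive (trans (+-cong (*-identityʳ x) (zeroʳ y)) (+-identityʳ x)))

  chineseRemainder : ∀ {k} {f : Fin k → Carrier} → PairwiseComaximal f →
                     ∀ (v : Fin k → Carrier) → ∃ λ p → ∀ i → p ≈ v i [mod f i ]
  chineseRemainder {zero}      _        v = 0# , λ ()
  chineseRemainder {suc k} {f} pairwise v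
    with comaximal⇒separator (comaximal-head-∏tail pairwise)
       | comaximal⇒separator (comaximal-sym (comaximal-head-∏tail pairwise))
       | chineseRemainder (pairwiseComaximal-tail pairwise) (v ∘ Fin.suc)
  ... | e , e≈1 , ∏∣e | e′ , e′≈1 , f₀∣e′ | q , q≈v = v Fin.zero * e + q * e′ , λ where
    Fin.zero    → *+*≈[mod] (v Fin.zero) q e≈1 (∣⇒≈0[mod] f₀∣e′)
    (Fin.suc i) → mod-trans (mod-∣ (∣∏ (f ∘ Fin.suc) i)
                    (mod-trans (mod-reflexive (+-comm _ _))
                               (*+*≈[mod] q (v Fin.zero) e′≈1 (∣⇒≈0[mod] ∏∣e))))
                    (q≈v i)

  indicator : ∀ {k} → Fin k → Fin k → Carrier
  indicator i j = if does (i Fin.≟ j) then 1# else 0#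

  indicator-diag : ∀ {k} (i : Fin k) → indicator i i ≡ 1#
  indicator-diag i = ≡.cong (if_then 1# else 0#) (dec-true (i Fin.≟ i) ≡.refl)

  indicator-off : ∀ {k} {i j : Fin k} → i ≢ j → indicator i j ≡ 0#
  indicator-off {i = i} {j} i≢j = ≡.cong (if_then 1# else 0#) (dec-false (i Fin.≟ j) i≢j)

  module _ {d} {D : Set d} (eval : D → Carrier) where

    CoversResiduesMod : Carrier → Set (c ⊔ ℓ ⊔ d)
    CoversResiduesMod F = ∀ a → ∃ λ x → a ≈ eval x [mod F ]

    CoversResidueTuplesMod : ∀ {k} → (Fin k → Carrier) → Set (c ⊔ ℓ ⊔ d)
    CoversResidueTuplesMod {k} f = ∀ (v : Fin k → Carrier) → ∃ λ x → ∀ i → v i ≈ eval x [mod f i ]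

    module _ {k} {f : Fin k → Carrier} where

      coversTuples⇒pairwiseComaximal : CoversResidueTuplesMod f → PairwiseComaximal f
      coversTuples⇒pairwiseComaximal covers i j i≢j =
        let x , δ≈x = covers (indicator i)
        in separator⇒comaximal
             (mod-sym (≡.subst (_≈ eval x [mod f i ]) (indicator-diag i) (δ≈x i)))
             (≈0[mod]⇒∣ (mod-sym (≡.subst (_≈ eval x [mod f j ]) (indicator-off i≢j) (δ≈x j))))

      coversTuples⇒coversMod∏ : CoversResidueTuplesMod f → CoversResiduesMod (∏ f)
      coversTuples⇒coversMod∏ covers a =
        let x , a≈x = covers (λ _ → a) in x , pairwiseComaximal⇒∏∣ (coversTuples⇒pairwiseComaximal covers) a≈x

      pairwiseComaximal⇒coversMod∏⇒coversTuples :
        PairwiseComaximal f → CoversResiduesMod (∏ f) → CoversResidueTuplesMod f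
      pairwiseComaximal⇒coversMod∏⇒coversTuples pairwise covers v =
        let p , p≈v = chineseRemainder pairwise v
            x , p≈x = covers p
        in x , λ i → mod-trans (mod-sym (p≈v i)) (mod-∣ (∣∏ f i) p≈x)

      coversTuples⇔pairwiseComaximal×coversMod∏ :
        CoversResidueTuplesMod f ⇔ (PairwiseComaximal f × CoversResiduesMod (∏ f))
      coversTuples⇔pairwiseComaximal×coversMod∏ = mk⇔
        (λ covers → coversTuples⇒pairwiseComaximal covers , coversTuples⇒coversMod∏ covers)
        (λ (pairwise , covers) → pairwiseComaximal⇒coversMod∏⇒coversTuples pairwise covers)

module PolynomialRing {c ℓ : Level} (E : CommutativeRing c ℓ) where
  open Over E
  open CommutativeRing E
  open import Algebra.Properties.Ring ring using (-0#≈0#)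

  coeff-+P : ∀ p q n → coeff (p +P q) n ≈ coeff p n + coeff q n
  coeff-+P []      q       n       = sym (+-identityˡ _)
  coeff-+P (a ∷ p) []      n       = sym (+-identityʳ _)
  coeff-+P (a ∷ p) (b ∷ q) zero    = refl
  coeff-+P (a ∷ p) (b ∷ q) (suc n) = coeff-+P p q n

  coeff-negP : ∀ p n → coeff (-P p) n ≈ - coeff p n
  coeff-negP []      n       = sym -0#≈0#
  coeff-negP (a ∷ p) zero    = refl
  coeff-negP (a ∷ p) (suc n) = coeff-negP p n

  coeff-·P : ∀ a p n → coeff (a ·P p) n ≈ a * coeff p n
  coeff-·P a []      n       = sym (zeroʳ a)
  coeff-·P a (b ∷ p) zero    = refl
  coeff-·P a (b ∷ p) (suc n) = coeff-·P a p n

  -- _≈P_ unfolds to a function type from which p and q cannot be inferred;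
  -- the record wrapper makes them inferable.
  infix 4 _≋_
  record _≋_ (p q : Pol) : Set ℓ where
    constructor coeffwise
    field coeff-≈ : p ≈P q
  open _≋_ public

  ≋-setoid : Setoid c ℓ
  ≋-setoid = record
    { Carrier       = Pol
    ; _≈_           = _≋_
    ; isEquivalence = record
      { refl  = coeffwise λ _ → refl
      ; sym   = λ (coeffwise p≈q) → coeffwise λ n → sym (p≈q n)
      ; trans = λ (coeffwise p≈q) (coeffwise q≈r) → coeffwise λ n → trans (p≈q n) (q≈r n)
      }
    }
  open Setoid ≋-setoid public using () renaming (refl to ≋-refl; sym to ≋-sym; trans to ≋-trans)
  open import Relation.Binary.Reasoning.Setoid ≋-setoid

  ∷-cong : ∀ {a b p q} → a ≈ b → p ≋ q → a ∷ p ≋ b ∷ q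
  ∷-cong a≈b (coeffwise p≈q) = coeffwise λ { zero → a≈b ; (suc n) → p≈q n }

  shift : Pol → Pol
  shift p = 0# ∷ p

  shift-cong : ∀ {p q} → p ≋ q → shift p ≋ shift q
  shift-cong = ∷-cong refl

  shift-0P : shift 0P ≋ 0P
  shift-0P = coeffwise λ { zero → refl ; (suc n) → refl }

  +P-cong : ∀ {p p′ q q′} → p ≋ p′ → q ≋ q′ → p +P q ≋ p′ +P q′
  +P-cong {p} {p′} {q} {q′} (coeffwise p≈p′) (coeffwise q≈q′) = coeffwise λ n →
    trans (coeff-+P p q n) (trans (+-cong (p≈p′ n) (q≈q′ n)) (sym (coeff-+P p′ q′ n)))

  +P-comm : ∀ p q → p +P q ≋ q +P p
  +P-comm p q = coeffwise λ n → trans (coeff-+P p q n) (trans (+-comm _ _) (sym (coeff-+P q p n)))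

  +P-assoc : ∀ p q r → (p +P q) +P r ≋ p +P (q +P r)
  +P-assoc p q r = coeffwise λ n →
    trans (coeff-+P (p +P q) r n) (trans (+-congʳ (coeff-+P p q n)) (trans (+-assoc _ _ _)
      (sym (trans (coeff-+P p (q +P r) n) (+-congˡ (coeff-+P q r n))))))

  +P-identityʳ : ∀ p → p +P 0P ≋ p
  +P-identityʳ p = coeffwise λ n → trans (coeff-+P p [] n) (+-identityʳ _)

  -P-cong : ∀ {p q} → p ≋ q → -P p ≋ -P q
  -P-cong {p} {q} (coeffwise p≈q) = coeffwise λ n →
    trans (coeff-negP p n) (trans (-‿cong (p≈q n)) (sym (coeff-negP q n)))

  -P-inverseˡ : ∀ p → (-P p) +P p ≋ 0P
  -P-inverseˡ p = coeffwise λ n → trans (coeff-+P (-P p) p n) (trans (+-congʳ (coeff-negP p n)) (-‿inverseˡ _))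

  -P-inverseʳ : ∀ p → p +P (-P p) ≋ 0P
  -P-inverseʳ p = coeffwise λ n → trans (coeff-+P p (-P p) n) (trans (+-congˡ (coeff-negP p n)) (-‿inverseʳ _))

  +P-isAbelianGroup : IsAbelianGroup _≋_ _+P_ 0P (-P_)
  +P-isAbelianGroup = record
    { isGroup = record
      { isMonoid = record
        { isSemigroup = record
          { isMagma = record { isEquivalence = Setoid.isEquivalence ≋-setoid ; ∙-cong = +P-cong }
          ; assoc   = +P-assoc
          }
        ; identity = (λ _ → ≋-refl) , +P-identityʳ
        }
      ; inverse = -P-inverseˡ , -P-inverseʳ
      ; ⁻¹-cong = -P-cong
      }
    ; comm = +P-comm
    }

  +P-abelianGroup : AbelianGroup c ℓ
  +P-abelianGroup = record { isAbelianGroup = +P-isAbelianGroup }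

  open import Algebra.Properties.CommutativeSemigroup (AbelianGroup.commutativeSemigroup +P-abelianGroup)
    using () renaming (interchange to +P-interchange; x∙yz≈y∙xz to +P-swap)

  shift-+P : ∀ p q → shift p +P shift q ≋ shift (p +P q)
  shift-+P p q = ∷-cong (+-identityˡ 0#) ≋-refl

  ·P-cong : ∀ {a b p q} → a ≈ b → p ≋ q → a ·P p ≋ b ·P q
  ·P-cong {a} {b} {p} {q} a≈b (coeffwise p≈q) = coeffwise λ n →
    trans (coeff-·P a p n) (trans (*-cong a≈b (p≈q n)) (sym (coeff-·P b q n)))

  ·P-distribˡ : ∀ a p q → a ·P (p +P q) ≋ (a ·P p) +P (a ·P q)
  ·P-distribˡ a p q = coeffwise λ n → trans (coeff-·P a (p +P q) n) (trans (*-congˡ (coeff-+P p q n))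
    (trans (distribˡ _ _ _)
      (sym (trans (coeff-+P (a ·P p) (a ·P q) n) (+-cong (coeff-·P a p n) (coeff-·P a q n))))))

  ·P-distribʳ : ∀ a b p → (a + b) ·P p ≋ (a ·P p) +P (b ·P p)
  ·P-distribʳ a b p = coeffwise λ n → trans (coeff-·P (a + b) p n) (trans (distribʳ _ _ _)
    (sym (trans (coeff-+P (a ·P p) (b ·P p) n) (+-cong (coeff-·P a p n) (coeff-·P b p n)))))

  ·P-assoc : ∀ a b p → a ·P (b ·P p) ≋ (a * b) ·P p
  ·P-assoc a b p = coeffwise λ n → trans (coeff-·P a (b ·P p) n) (trans (*-congˡ (coeff-·P b p n))
    (trans (sym (*-assoc _ _ _)) (sym (coeff-·P (a * b) p n))))

  ·P-identityˡ : ∀ p → 1# ·P p ≋ p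
  ·P-identityˡ p = coeffwise λ n → trans (coeff-·P 1# p n) (*-identityˡ _)

  ·P-zeroˡ : ∀ p → 0# ·P p ≋ 0P
  ·P-zeroˡ p = coeffwise λ n → trans (coeff-·P 0# p n) (zeroˡ _)

  ·P-shift : ∀ a p → a ·P shift p ≋ shift (a ·P p)
  ·P-shift a p = ∷-cong (zeroʳ a) ≋-refl

  *P-congʳ : ∀ p {q q′} → q ≋ q′ → p *P q ≋ p *P q′
  *P-congʳ []      q≈q′ = ≋-refl
  *P-congʳ (a ∷ p) q≈q′ = +P-cong (·P-cong refl q≈q′) (shift-cong (*P-congʳ p q≈q′))

  *P-zeroʳ : ∀ p → p *P 0P ≋ 0P
  *P-zeroʳ []      = ≋-refl
  *P-zeroʳ (a ∷ p) = ≋-trans (shift-cong (*P-zeroʳ p)) shift-0P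

  *P-∷ʳ : ∀ p b q → p *P (b ∷ q) ≋ (b ·P p) +P shift (p *P q)
  *P-∷ʳ []      b q = ≋-sym shift-0P
  *P-∷ʳ (a ∷ p) b q = begin
    (a ·P (b ∷ q)) +P shift (p *P (b ∷ q))
      ≈⟨ +P-cong (≋-refl {(a * b) ∷ (a ·P q)}) (shift-cong (*P-∷ʳ p b q)) ⟩
    ((a * b) ∷ (a ·P q)) +P (0# ∷ ((b ·P p) +P shift (p *P q)))
      ≈⟨ ∷-cong (+-congʳ (*-comm a b)) (+P-swap (a ·P q) (b ·P p) (shift (p *P q))) ⟩
    ((b * a) ∷ (b ·P p)) +P (0# ∷ ((a ·P q) +P shift (p *P q)))
      ∎

  *P-comm : ∀ p q → p *P q ≋ q *P p
  *P-comm []      q = ≋-sym (*P-zeroʳ q)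
  *P-comm (a ∷ p) q = ≋-trans (+P-cong ≋-refl (shift-cong (*P-comm p q))) (≋-sym (*P-∷ʳ q a p))

  *P-congˡ : ∀ {p p′} q → p ≋ p′ → p *P q ≋ p′ *P q
  *P-congˡ {p} {p′} q p≈p′ = ≋-trans (*P-comm p q) (≋-trans (*P-congʳ q p≈p′) (*P-comm q p′))

  *P-distribʳ : ∀ r p q → (p +P q) *P r ≋ (p *P r) +P (q *P r)
  *P-distribʳ r []      q       = ≋-refl
  *P-distribʳ r (a ∷ p) []      = ≋-sym (+P-identityʳ _)
  *P-distribʳ r (a ∷ p) (b ∷ q) = begin
    ((a + b) ·P r) +P shift ((p +P q) *P r)
      ≈⟨ +P-cong (·P-distribʳ a b r)
                 (≋-trans (shift-cong (*P-distribʳ r p q)) (≋-sym (shift-+P (p *P r) (q *P r)))) ⟩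
    ((a ·P r) +P (b ·P r)) +P (shift (p *P r) +P shift (q *P r))
      ≈⟨ +P-interchange (a ·P r) (b ·P r) (shift (p *P r)) (shift (q *P r)) ⟩
    ((a ·P r) +P shift (p *P r)) +P ((b ·P r) +P shift (q *P r))
      ∎

  *P-distribˡ : ∀ p q r → p *P (q +P r) ≋ (p *P q) +P (p *P r)
  *P-distribˡ p q r =
    ≋-trans (*P-comm p (q +P r)) (≋-trans (*P-distribʳ p q r) (+P-cong (*P-comm q p) (*P-comm r p)))

  ·P-*P : ∀ a q r → (a ·P q) *P r ≋ a ·P (q *P r)
  ·P-*P a []      r = ≋-refl
  ·P-*P a (b ∷ q) r = begin
    ((a * b) ·P r) +P shift ((a ·P q) *P r)
      ≈⟨ +P-cong (≋-sym (·P-assoc a b r)) (shift-cong (·P-*P a q r)) ⟩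
    (a ·P (b ·P r)) +P shift (a ·P (q *P r))
      ≈⟨ +P-cong ≋-refl (≋-sym (·P-shift a (q *P r))) ⟩
    (a ·P (b ·P r)) +P (a ·P shift (q *P r))
      ≈⟨ ·P-distribˡ a (b ·P r) (shift (q *P r)) ⟨
    a ·P ((b ·P r) +P shift (q *P r))
      ∎

  shift-*P : ∀ p q → shift p *P q ≋ shift (p *P q)
  shift-*P p q = +P-cong (·P-zeroˡ q) ≋-refl

  *P-assoc : ∀ p q r → (p *P q) *P r ≋ p *P (q *P r)
  *P-assoc []      q r = ≋-refl
  *P-assoc (a ∷ p) q r = begin
    ((a ·P q) +P shift (p *P q)) *P r
      ≈⟨ *P-distribʳ r (a ·P q) (shift (p *P q)) ⟩
    ((a ·P q) *P r) +P (shift (p *P q) *P r)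
      ≈⟨ +P-cong (·P-*P a q r) (≋-trans (shift-*P (p *P q) r) (shift-cong (*P-assoc p q r))) ⟩
    (a ·P (q *P r)) +P shift (p *P (q *P r))
      ∎

  *P-identityˡ : ∀ p → 1P *P p ≋ p
  *P-identityˡ p = ≋-trans (+P-cong (·P-identityˡ p) shift-0P) (+P-identityʳ p)

  polynomialRing : CommutativeRing c ℓ
  polynomialRing = record
    { Carrier           = Pol
    ; _≈_               = _≋_
    ; _+_               = _+P_
    ; _*_               = _*P_
    ; -_                = (-P_)
    ; 0#                = 0P
    ; 1#                = 1P
    ; isCommutativeRing = record
      { isRing = record
        { +-isAbelianGroup = +P-isAbelianGroup
        ; *-cong           = λ {p} {p′} {q} {q′} p≈p′ q≈q′ → ≋-trans (*P-congˡ q p≈p′) (*P-congʳ p′ q≈q′)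
        ; *-assoc          = *P-assoc
        ; *-identity       = *P-identityˡ , λ p → ≋-trans (*P-comm p 1P) (*P-identityˡ p)
        ; distrib          = *P-distribˡ , *P-distribʳ
        }
      ; *-comm = *P-comm
      }
    }

module DigitExpansions {c ℓ r : Level} (E : CommutativeRing c ℓ) (ℛ : Pred (Over.Pol E) r) where
  open Over E
  open PolynomialRing E
  open Comaximality polynomialRing

  Expansion : Set (c ⊔ r)
  Expansion = ∃ λ ℓ′ → ∃ λ (ds : Vec Pol (suc ℓ′)) → All ℛ ds

  value : Expansion → Pol
  value (_ , ds , _) = horner ds

  ≡P[mod]⇔≈[mod] : ∀ f a b → a ≡P b [mod f ] ⇔ a ≈ b [mod f ]
  ≡P[mod]⇔≈[mod] f a b = mk⇔
    (λ (h , a-b≈fh) → h , ≋-trans (*P-comm h f) (≋-sym (coeffwise a-b≈fh)))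
    (λ (q , qf≋a-b) → q , coeff-≈ (≋-sym (≋-trans (*P-comm f q) qf≋a-b)))

  prodP≡∏ : ∀ {k} (f : Fin k → Pol) → prodP f ≡ ∏ f
  prodP≡∏ {zero}  f = ≡.refl
  prodP≡∏ {suc k} f = ≡.cong (f Fin.zero *P_) (prodP≡∏ (f ∘ Fin.suc))

  FEP⇔coversResiduesMod : ∀ F → FEP F ℛ ⇔ CoversResiduesMod value F
  FEP⇔coversResiduesMod F = mk⇔ to from
    where
    to : FEP F ℛ → CoversResiduesMod value F
    to fep a =
      let ℓ′ , ds , ds∈ℛ , a≡ds = fep a
      in (ℓ′ , ds , ds∈ℛ) , Equivalence.to (≡P[mod]⇔≈[mod] F a (horner ds)) a≡ds
    from : CoversResiduesMod value F → FEP F ℛ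
    from covers a =
      let (ℓ′ , ds , ds∈ℛ) , a≈ds = covers a
      in ℓ′ , ds , ds∈ℛ , Equivalence.from (≡P[mod]⇔≈[mod] F a (horner ds)) a≈ds

  FEP-prodP⇔coversResiduesMod∏ : ∀ {k} (f : Fin k → Pol) → FEP (prodP f) ℛ ⇔ CoversResiduesMod value (∏ f)
  FEP-prodP⇔coversResiduesMod∏ f =
    ≡.subst (λ F → FEP (prodP f) ℛ ⇔ CoversResiduesMod value F) (prodP≡∏ f)
            (FEP⇔coversResiduesMod (prodP f))

  SimFEP⇔coversResidueTuplesMod : ∀ {k} (f : Fin k → Pol) → SimFEP k f ℛ ⇔ CoversResidueTuplesMod value f
  SimFEP⇔coversResidueTuplesMod {k} f = mk⇔ to from
    where
    to : SimFEP k f ℛ → CoversResidueTuplesMod value f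
    to fep v =
      let ℓ′ , ds , ds∈ℛ , v≡ds = fep v
      in (ℓ′ , ds , ds∈ℛ) , λ i → Equivalence.to (≡P[mod]⇔≈[mod] (f i) (v i) (horner ds)) (v≡ds i)
    from : CoversResidueTuplesMod value f → SimFEP k f ℛ
    from covers v =
      let (ℓ′ , ds , ds∈ℛ) , v≈ds = covers v
      in ℓ′ , ds , ds∈ℛ , λ i → Equivalence.from (≡P[mod]⇔≈[mod] (f i) (v i) (horner ds)) (v≈ds i)

  pairwiseUnitIdeal⇔pairwiseComaximal : ∀ {k} (f : Fin k → Pol) →
    (∀ i j → ¬ (i ≡ j) → UnitIdeal (f i) (f j)) ⇔ PairwiseComaximal f
  pairwiseUnitIdeal⇔pairwiseComaximal f = mk⇔ to from
    where
    to : (∀ i j → ¬ (i ≡ j) → UnitIdeal (f i) (f j)) → PairwiseComaximal f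
    to unit i j i≢j = let u , v , uf+vg≈1 = unit i j i≢j in u , v , coeffwise uf+vg≈1
    from : PairwiseComaximal f → ∀ i j → ¬ (i ≡ j) → UnitIdeal (f i) (f j)
    from comaximal i j i≢j = let u , v , uf+vg≋1 = comaximal i j i≢j in u , v , coeff-≈ uf+vg≋1

theorem4p4 : ∀ {c ℓ r : Level} (E : CommutativeRing c ℓ) → Over.IsPID E →
    (k : ℕ) → 1 ≤ k → (f : Fin k → Over.Pol E) (ℛ : Pred (Over.Pol E) r) →
    Over.IsSimDigitSystem E k f ℛ →
    (Over.SimFEP E k f ℛ ⇔
      ((∀ i j → ¬ (i ≡ j) → Over.UnitIdeal E (f i) (f j)) × Over.FEP E (Over.prodP E f) ℛ))
theorem4p4 E _ k _ f ℛ _ =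
  SimFEP⇔coversResidueTuplesMod f
    ⟨ ⇔-trans ⟩ coversTuples⇔pairwiseComaximal×coversMod∏ value
    ⟨ ⇔-trans ⟩ ⇔-sym (pairwiseUnitIdeal⇔pairwiseComaximal f ×-⇔ FEP-prodP⇔coversResiduesMod∏ f)
  where
  open DigitExpansions E ℛ
  open Comaximality (PolynomialRing.polynomialRing E)
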